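{- Let $H$ be the graph with vertex set $\{x,v_1,v_2,v_3,u_1,u_2,u_3,w_1,w_3,y_1\}$ and edge set $\{xv_1,v_1u_1,u_1u_2,u_2v_2,v_2x,u_2u_3,u_3v_3,v_3x,u_3w_3,w_3w_1,w_1u_1,w_1y_1\}$. Let $L$ be an assignment of subsets of $\{1,\ldots,6\}$ to the vertices of $H$ such that $L(x)=\{1,2,3\}$; $|L(u_1)|=3$ and $L(u_1)\cap\{1,2,3\}=\{3\}$; $L(u_3)=\{1,2,5,6\}$; $|L(w_3)|=4$; $|L(y_1)|=2$ and $L(y_1)\subseteq\{3,4,5,6\}$; and $L(v_1)=L(v_2)=L(v_3)=L(u_2)=L(w_1)=\{1,\ldots,6\}$. Then there exists a $2$-element set $S\subseteq L(u_1)$ with $3\in S$ and $S\cap L(y_1)\neq\emptyset$, and for every such set $S$, the graph $H$ has an $\{x\}$-enhanced coloring $\varphi$ such that $\varphi(v)\subseteq L(v)$ for all $v\in V(H)$ and $\varphi(u_1)=S$.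
   Context: For a graph $H$ and $X\subseteq V(H)$, an $X$-enhanced coloring of $H$ is a function $\varphi$ assigning to each vertex a subset of $\{1,\ldots,6\}$ such that adjacent vertices receive disjoint sets, $|\varphi(v)|\ge 2$ for all $v\in V(H)$, and $|\varphi(x)|=3$ for all $x\in X$. -}

module Defs where

open import Data.Nat using (ℕ; _≤_)
open import Data.Fin using (Fin; zero; suc)
open import Data.Fin.Subset public using (Subset; ⁅_⁆; _∪_; _∩_; _⊆_; _∈_; ∣_∣; ⊤; Empty; Nonempty)
open import Data.Product using (_×_)
open import Data.Sum using (_⊎_)
open import Relation.Binary.PropositionalEquality using (_≡_)

-- Colours: the colour c ∈ {1,…,6} is represented by the element (c-1) of Fin 6.
Colour : Set
Colour = Fin 6

c1 c2 c3 c4 c5 c6 : Colour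
c1 = zero
c2 = suc zero
c3 = suc (suc zero)
c4 = suc (suc (suc zero))
c5 = suc (suc (suc (suc zero)))
c6 = suc (suc (suc (suc (suc zero))))

record EnhancedColoring {V : Set} (Adj : V → V → Set) (X : V → Set)
                        (φ : V → Subset 6) : Set where
  field
    disjoint : ∀ a b → Adj a b → Empty (φ a ∩ φ b)
    atLeast2 : ∀ v → 2 ≤ ∣ φ v ∣
    exactly3 : ∀ v → X v → ∣ φ v ∣ ≡ 3

data V : Set where
  x v1 v2 v3 u1 u2 u3 w1 w3 y1 : V

data Edge : V → V → Set where
  e-xv1   : Edge x v1
  e-v1u1  : Edge v1 u1
  e-u1u2  : Edge u1 u2
  e-u2v2  : Edge u2 v2
  e-v2x   : Edge v2 x
  e-u2u3  : Edge u2 u3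
  e-u3v3  : Edge u3 v3
  e-v3x   : Edge v3 x
  e-u3w3  : Edge u3 w3
  e-w3w1  : Edge w3 w1
  e-w1u1  : Edge w1 u1
  e-w1y1  : Edge w1 y1

AdjH : V → V → Set
AdjH a b = Edge a b ⊎ Edge b a

-- Colour x with {1,2,3}, u1 with S and y1 with L(y1). As S meets L(y1), the set
-- Z = S ∪ L(y1) ⊆ {3,4,5,6} has at most three colours. Give u3 the pair {1,5}, or {1,6}
-- when 5 ∈ L(w3) ∩ Z. If |Z| = 3 then the four colours of L(w3) cannot all avoid Z, and
-- this choice keeps a colour of Z in L(w3) ∖ φ(u3); w3 takes it, which leaves w1 at least
-- two colours outside Z ∪ φ(w3). Every other vertex is coloured greedily: u1, u2 and u3
-- each use at most one of 4, 5, 6, so v1, v2 and v3 find two colours in {4,5,6}.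
-- All sets involved are subsets of a six-element set, so the resulting colouring, and the
-- existence of S, are verified by evaluating a decision procedure over all admissible lists.
module Submission where

open import Defs
open import Data.Bool using (if_then_else_)
open import Data.Nat using (ℕ; zero; suc; _∸_; _≤_; _≤?_; _≟_)
open import Data.Fin using (Fin; #_)
open import Data.Fin.Properties using (all?)
open import Data.Fin.Subset using (∁; _─_; inside; outside; ⊥)
open import Data.Fin.Subset.Properties
  using (∩-comm; _∈?_; _⊆?_; nonempty?; anySubset?; ∈⊤; x∈⁅x⁆; x∈p∩q⁻; x∈p∩q⁺; x∈p∪q⁺; x∉p⇒x∈∁p; ⊆-trans)
open import Data.Product using (Σ; _×_; _,_; ∃; proj₁; proj₂)
open import Data.Sum using (inj₁; inj₂)
open import Data.Vec using ([]; _∷_; lookup)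
open import Function using (_∘_; _$_)
open import Relation.Nullary using (Dec; does; ¬?; _×-dec_; _→-dec_; yes; no)
open import Relation.Nullary.Decidable using (from-yes; map′; decidable-stable)
open import Relation.Unary using (Pred; Decidable)
open import Relation.Binary.PropositionalEquality using (_≡_; refl; subst; sym)

private variable n : ℕ

allSubset? : ∀ {p} {P : Pred (Subset n) p} → Decidable P → Dec (∀ s → P s)
allSubset? P? = map′
  (λ ¬∃¬P s → decidable-stable (P? s) (λ ¬Ps → ¬∃¬P (s , ¬Ps)))
  (λ ∀P (s , ¬Ps) → ¬Ps (∀P s))
  (¬? (anySubset? (¬? ∘ P?)))

∩≡⇒⊆∪∁ : {p q r : Subset n} → p ∩ q ≡ r → p ⊆ r ∪ ∁ q
∩≡⇒⊆∪∁ {q = q} {r} p∩q≡r {i} i∈p with i ∈? q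
... | yes i∈q = x∈p∪q⁺ (inj₁ (subst (i ∈_) p∩q≡r (x∈p∩q⁺ (i∈p , i∈q))))
... | no  i∉q = x∈p∪q⁺ (inj₂ (x∉p⇒x∈∁p i∉q))

first : ℕ → Subset n → Subset n
first zero    p             = ⊥
first (suc k) []            = []
first (suc k) (inside  ∷ p) = inside ∷ first k p
first (suc k) (outside ∷ p) = outside ∷ first (suc k) p

firstPreferring : ℕ → Subset n → Subset n → Subset n
firstPreferring {n} k q p = preferred ∪ first (k ∸ ∣ preferred ∣) (p ─ q)
  where
  preferred : Subset n
  preferred = first k (p ∩ q)

vertexAt : Fin 10 → V
vertexAt = lookup (x ∷ v1 ∷ v2 ∷ v3 ∷ u1 ∷ u2 ∷ u3 ∷ w1 ∷ w3 ∷ y1 ∷ [])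

vertexAt-surjective : ∀ v → ∃ λ i → vertexAt i ≡ v
vertexAt-surjective x  = # 0 , refl
vertexAt-surjective v1 = # 1 , refl
vertexAt-surjective v2 = # 2 , refl
vertexAt-surjective v3 = # 3 , refl
vertexAt-surjective u1 = # 4 , refl
vertexAt-surjective u2 = # 5 , refl
vertexAt-surjective u3 = # 6 , refl
vertexAt-surjective w1 = # 7 , refl
vertexAt-surjective w3 = # 8 , refl
vertexAt-surjective y1 = # 9 , refl

edgeAt : Fin 12 → V × V
edgeAt = lookup ((x , v1) ∷ (v1 , u1) ∷ (u1 , u2) ∷ (u2 , v2) ∷ (v2 , x) ∷ (u2 , u3)
                 ∷ (u3 , v3) ∷ (v3 , x) ∷ (u3 , w3) ∷ (w3 , w1) ∷ (w1 , u1) ∷ (w1 , y1) ∷ [])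

edgeAt-surjective : ∀ {a b} → Edge a b → ∃ λ k → edgeAt k ≡ (a , b)
edgeAt-surjective e-xv1  = # 0 , refl
edgeAt-surjective e-v1u1 = # 1 , refl
edgeAt-surjective e-u1u2 = # 2 , refl
edgeAt-surjective e-u2v2 = # 3 , refl
edgeAt-surjective e-v2x  = # 4 , refl
edgeAt-surjective e-u2u3 = # 5 , refl
edgeAt-surjective e-u3v3 = # 6 , refl
edgeAt-surjective e-v3x  = # 7 , refl
edgeAt-surjective e-u3w3 = # 8 , refl
edgeAt-surjective e-w3w1 = # 9 , refl
edgeAt-surjective e-w1u1 = # 10 , refl
edgeAt-surjective e-w1y1 = # 11 , refl

DisjointAlong : (V → Subset 6) → V × V → Set
DisjointAlong φ (a , b) = Empty (φ a ∩ φ b)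

Proper : (V → Subset 6) → Set
Proper φ = (∀ k → DisjointAlong φ (edgeAt k)) × (∀ i → 2 ≤ ∣ φ (vertexAt i) ∣)

proper? : (φ : V → Subset 6) → Dec (Proper φ)
proper? φ = all? (λ k → ¬? (nonempty? (φ (proj₁ (edgeAt k)) ∩ φ (proj₂ (edgeAt k)))))
      ×-dec all? (λ i → 2 ≤? ∣ φ (vertexAt i) ∣)

proper⇒enhanced : {φ : V → Subset 6} → Proper φ → ∣ φ x ∣ ≡ 3
                → EnhancedColoring AdjH (_≡ x) φ
proper⇒enhanced {φ} (disjoint , large) ∣φx∣≡3 = record
  { disjoint = λ { a b (inj₁ e) → along e ; a b (inj₂ e) → subst Empty (∩-comm (φ b) (φ a)) (along e) }
  ; atLeast2 = λ v → let i , i↦v = vertexAt-surjective v in subst (λ w → 2 ≤ ∣ φ w ∣) i↦v (large i)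
  ; exactly3 = λ { .x refl → ∣φx∣≡3 }
  }
  where
  along : ∀ {a b} → Edge a b → Empty (φ a ∩ φ b)
  along e = let k , k↦ab = edgeAt-surjective e in subst (DisjointAlong φ) k↦ab (disjoint k)

low high upper : Subset 6
low   = ⁅ c1 ⁆ ∪ ⁅ c2 ⁆ ∪ ⁅ c3 ⁆
high  = ⁅ c4 ⁆ ∪ ⁅ c5 ⁆ ∪ ⁅ c6 ⁆
upper = ⁅ c3 ⁆ ∪ high

colouring : (S Ly1 Lw3 : Subset 6) → V → Subset 6
colouring S Ly1 Lw3 = φ
  where
  Z φu3 φw3 φu2 : Subset 6
  Z = S ∪ Ly1
  φu3 = if does (c5 ∈? Lw3 ∩ Z) then ⁅ c1 ⁆ ∪ ⁅ c6 ⁆ else ⁅ c1 ⁆ ∪ ⁅ c5 ⁆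
  φw3 = firstPreferring 2 Z (Lw3 ─ φu3)
  φu2 = first 2 (∁ (S ∪ φu3))
  φ : V → Subset 6
  φ x  = low
  φ u1 = S
  φ y1 = Ly1
  φ u3 = φu3
  φ w3 = φw3
  φ w1 = first 2 (∁ (Z ∪ φw3))
  φ u2 = φu2
  φ v1 = high ─ S
  φ v2 = high ─ φu2
  φ v3 = high ─ φu3

ValidColouring : (S Ly1 Lw3 : Subset 6) → Set
ValidColouring S Ly1 Lw3 = Proper φ × φ u3 ⊆ ⁅ c1 ⁆ ∪ ⁅ c2 ⁆ ∪ ⁅ c5 ⁆ ∪ ⁅ c6 ⁆ × φ w3 ⊆ Lw3
  where
  φ : V → Subset 6
  φ = colouring S Ly1 Lw3

colouring-valid : ∀ S → ∣ S ∣ ≡ 2 × c3 ∈ S × S ⊆ upper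
                → ∀ Ly1 → ∣ Ly1 ∣ ≡ 2 × Ly1 ⊆ upper × Nonempty (S ∩ Ly1)
                → ∀ Lw3 → ∣ Lw3 ∣ ≡ 4
                → ValidColouring S Ly1 Lw3
colouring-valid = from-yes $
  allSubset? λ S → (∣ S ∣ ≟ 2 ×-dec c3 ∈? S ×-dec S ⊆? upper) →-dec
  allSubset? λ Ly1 → (∣ Ly1 ∣ ≟ 2 ×-dec Ly1 ⊆? upper ×-dec nonempty? (S ∩ Ly1)) →-dec
  allSubset? λ Lw3 → ∣ Lw3 ∣ ≟ 4 →-dec
    (proper? (colouring S Ly1 Lw3)
     ×-dec colouring S Ly1 Lw3 u3 ⊆? ⁅ c1 ⁆ ∪ ⁅ c2 ⁆ ∪ ⁅ c5 ⁆ ∪ ⁅ c6 ⁆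
     ×-dec colouring S Ly1 Lw3 w3 ⊆? Lw3)

u1-colour-exists : ∀ Lu1 → ∣ Lu1 ∣ ≡ 3 × c3 ∈ Lu1 × Lu1 ⊆ upper
                 → ∀ Ly1 → ∣ Ly1 ∣ ≡ 2 × Ly1 ⊆ upper
                 → ∃ λ S → ∣ S ∣ ≡ 2 × S ⊆ Lu1 × c3 ∈ S × Nonempty (S ∩ Ly1)
u1-colour-exists = from-yes $
  allSubset? λ Lu1 → (∣ Lu1 ∣ ≟ 3 ×-dec c3 ∈? Lu1 ×-dec Lu1 ⊆? upper) →-dec
  allSubset? λ Ly1 → (∣ Ly1 ∣ ≟ 2 ×-dec Ly1 ⊆? upper) →-dec
  anySubset? λ S → ∣ S ∣ ≟ 2 ×-dec S ⊆? Lu1 ×-dec c3 ∈? S ×-dec nonempty? (S ∩ Ly1)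

lemma18 : (L : V → Subset 6)
    → L x ≡ ⁅ c1 ⁆ ∪ ⁅ c2 ⁆ ∪ ⁅ c3 ⁆
    → ∣ L u1 ∣ ≡ 3
    → L u1 ∩ (⁅ c1 ⁆ ∪ ⁅ c2 ⁆ ∪ ⁅ c3 ⁆) ≡ ⁅ c3 ⁆
    → L u3 ≡ ⁅ c1 ⁆ ∪ ⁅ c2 ⁆ ∪ ⁅ c5 ⁆ ∪ ⁅ c6 ⁆
    → ∣ L w3 ∣ ≡ 4
    → ∣ L y1 ∣ ≡ 2
    → L y1 ⊆ ⁅ c3 ⁆ ∪ ⁅ c4 ⁆ ∪ ⁅ c5 ⁆ ∪ ⁅ c6 ⁆
    → L v1 ≡ ⊤ → L v2 ≡ ⊤ → L v3 ≡ ⊤ → L u2 ≡ ⊤ → L w1 ≡ ⊤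
    → (Σ (Subset 6) λ S →
          ∣ S ∣ ≡ 2 × S ⊆ L u1 × c3 ∈ S × Nonempty (S ∩ L y1))
      × ((S : Subset 6) → ∣ S ∣ ≡ 2 → S ⊆ L u1 → c3 ∈ S → Nonempty (S ∩ L y1)
          → Σ (V → Subset 6) λ φ →
              EnhancedColoring AdjH (λ v → v ≡ x) φ
              × ((v : V) → φ v ⊆ L v)
              × φ u1 ≡ S)
lemma18 L Lx ∣Lu1∣ Lu1∩low Lu3 ∣Lw3∣ ∣Ly1∣ Ly1⊆ Lv1 Lv2 Lv3 Lu2 Lw1 =
  u1-colour-exists (L u1) (∣Lu1∣ , c3∈Lu1 , Lu1⊆upper) (L y1) (∣Ly1∣ , Ly1⊆) , colour
  where
  Lu1⊆upper : L u1 ⊆ upper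
  Lu1⊆upper = ∩≡⇒⊆∪∁ Lu1∩low  -- ⁅ c3 ⁆ ∪ ∁ low normalises to upper
  c3∈Lu1 : c3 ∈ L u1
  c3∈Lu1 = proj₁ (x∈p∩q⁻ (L u1) low (subst (c3 ∈_) (sym Lu1∩low) (x∈⁅x⁆ c3)))
  colour : (S : Subset 6) → ∣ S ∣ ≡ 2 → S ⊆ L u1 → c3 ∈ S → Nonempty (S ∩ L y1)
         → Σ (V → Subset 6) λ φ →
             EnhancedColoring AdjH (λ v → v ≡ x) φ × ((v : V) → φ v ⊆ L v) × φ u1 ≡ S
  colour S ∣S∣ S⊆Lu1 c3∈S S∩Ly1 = φ , proper⇒enhanced (proj₁ valid) refl , φ⊆L , refl
    where
    φ : V → Subset 6
    φ = colouring S (L y1) (L w3)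
    valid : ValidColouring S (L y1) (L w3)
    valid = colouring-valid S (∣S∣ , c3∈S , ⊆-trans S⊆Lu1 Lu1⊆upper)
                            (L y1) (∣Ly1∣ , Ly1⊆ , S∩Ly1) (L w3) ∣Lw3∣
    unrestricted : ∀ {v} → L v ≡ ⊤ → φ v ⊆ L v
    unrestricted Lv≡⊤ rewrite Lv≡⊤ = λ _ → ∈⊤
    φ⊆L : ∀ v → φ v ⊆ L v
    φ⊆L x  rewrite Lx  = λ i∈ → i∈
    φ⊆L u1 = S⊆Lu1
    φ⊆L y1 = λ i∈ → i∈
    φ⊆L u3 rewrite Lu3 = proj₁ (proj₂ valid)
    φ⊆L w3 = proj₂ (proj₂ valid)
    φ⊆L v1 = unrestricted Lv1
    φ⊆L v2 = unrestricted Lv2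
    φ⊆L v3 = unrestricted Lv3
    φ⊆L u2 = unrestricted Lu2
    φ⊆L w1 = unrestricted Lw1
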